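{- Let $T$ be the set of all trajectories in $\mathbb{R}^2$ (polygonal curves with any finite number of waypoints) and $\mathcal{R}_2$ the family of axis-aligned rectangles in $\mathbb{R}^2$. The range space with ground set $T$ whose ranges are, for each $R\in\mathcal{R}_2$, the set of trajectories $t\in T$ with $t\cap R\neq\emptyset$, has unbounded (infinite) VC-dimension.
   Context: A trajectory with waypoints $p_1,\ldots,p_m$ is the polygonal curve formed by the segments $\overline{p_jp_{j+1}}$; there is no bound on the number $m$ of waypoints. -}

module Defs where

open import Level using (Level; suc; _⊔_)
open import Data.Nat using (ℕ)
open import Data.Bool using (Bool; true; false)
open import Data.Fin using (Fin)
open import Data.Fin.Subset using (Subset; _∈_)
open import Data.List.NonEmpty using (List⁺; _∷_)
open import Data.List using (List; []; _∷_)
open import Data.Product using (Σ; ∃; _×_; _,_)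
open import Data.Sum using (_⊎_)
open import Data.Empty using (⊥)
open import Relation.Nullary using (¬_)
open import Relation.Binary.PropositionalEquality using (_≡_)
open import Function.Bundles using (_⇔_)
open import Algebra.Structures using (IsCommutativeRing)

-- The real numbers, axiomatised as a complete ordered field.
-- (agda-stdlib has no ℝ; the statement is quantified over every model
-- of these axioms, which classically is exactly ℝ up to isomorphism.)

record RealField (ℓ : Level) : Set (suc ℓ) where
  infixl 6 _+_
  infixl 7 _*_
  infix  4 _≤_
  field
    Carrier : Set ℓ
    _+_ _*_ : Carrier → Carrier → Carrier
    -_      : Carrier → Carrier
    0# 1#   : Carrier
    _≤_     : Carrier → Carrier → Set ℓ
    isCommutativeRing : IsCommutativeRing _≡_ _+_ _*_ -_ 0# 1#
    0≢1     : ¬ (0# ≡ 1#)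
    inverse : ∀ x → ¬ (x ≡ 0#) → Σ Carrier (λ y → x * y ≡ 1#)
    ≤-refl  : ∀ {x} → x ≤ x
    ≤-trans : ∀ {x y z} → x ≤ y → y ≤ z → x ≤ z
    ≤-antisym : ∀ {x y} → x ≤ y → y ≤ x → x ≡ y
    ≤-total : ∀ x y → x ≤ y ⊎ y ≤ x
    +-mono-≤ : ∀ {x y} z → x ≤ y → x + z ≤ y + z
    *-nonneg : ∀ {x y} → 0# ≤ x → 0# ≤ y → 0# ≤ x * y
    complete : (P : Carrier → Set ℓ) → Σ Carrier P →
               Σ Carrier (λ b → ∀ x → P x → x ≤ b) →
               Σ Carrier (λ s → (∀ x → P x → x ≤ s) ×
                                (∀ b → (∀ x → P x → x ≤ b) → s ≤ b))

module Plane {ℓ : Level} (ℝ : RealField ℓ) where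
  open RealField ℝ

  Point : Set ℓ
  Point = Carrier × Carrier

  OnSegment : Point → Point → Point → Set ℓ
  OnSegment (x₁ , y₁) (x₂ , y₂) (qx , qy) =
    Σ Carrier λ t → (0# ≤ t) × (t ≤ 1#) ×
      (qx ≡ x₁ + t * (x₂ + - x₁)) × (qy ≡ y₁ + t * (y₂ + - y₁))

  Trajectory : Set ℓ
  Trajectory = List⁺ Point

  OnPath : Point → List Point → Point → Set ℓ
  OnPath p []        q = q ≡ p
  OnPath p (p' ∷ ps) q = OnSegment p p' q ⊎ OnPath p' ps q

  OnTrajectory : Trajectory → Point → Set ℓ
  OnTrajectory (p ∷ ps) q = OnPath p ps q

  record Rectangle : Set ℓ where
    constructor rect
    field
      x₁ x₂ y₁ y₂ : Carrier
      x₁≤x₂ : x₁ ≤ x₂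
      y₁≤y₂ : y₁ ≤ y₂

  InRectangle : Rectangle → Point → Set ℓ
  InRectangle (rect x₁ x₂ y₁ y₂ _ _) (qx , qy) =
    (x₁ ≤ qx) × (qx ≤ x₂) × (y₁ ≤ qy) × (qy ≤ y₂)

  Meets : Trajectory → Rectangle → Set ℓ
  Meets t R = Σ Point λ q → OnTrajectory t q × InRectangle R q

  Shattered : (n : ℕ) → (Fin n → Trajectory) → Set ℓ
  Shattered n ts = (S : Subset n) → Σ Rectangle λ R →
    ∀ (i : Fin n) → (i ∈ S) ⇔ Meets (ts i) R

  -- infinite VC-dimension: arbitrarily large finite shattered sets
  -- (shattering forces the ts i to be pairwise distinct for n ≥ 2)
  UnboundedVCDim : Set ℓ
  UnboundedVCDim = ∀ (n : ℕ) → Σ (Fin n → Trajectory) (Shattered n)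

-- Put an apex at (0, 1) and give every subset S of the n trajectories
-- its own point x_S on the x-axis. Trajectory i starts at the apex and,
-- for each S containing i, runs down to (x_S, 0) and back up. Such a
-- zigzag meets the x-axis exactly in the points x_S with i ∈ S, so the
-- degenerate rectangle {(x_S, 0)} is met by precisely the trajectories
-- indexed by S. For x_S take the binary code of S, read in the field;
-- these are distinct because an ordered field has characteristic zero.
module Submission where

open import Defs
open import Level using (Level)
open import Data.Nat as ℕ using (ℕ; zero; suc)
open import Data.Nat.Properties using (*-cancelˡ-≡; suc-injective; even≢odd)
open import Data.Fin using (Fin)
open import Data.Fin.Subset using (Subset; inside; outside; _∈_)
open import Data.Fin.Subset.Properties using (_∈?_)
open import Data.Vec using ([]; _∷_)
open import Data.List using (List; []; _∷_; _++_; map; filter)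
open import Data.List.NonEmpty using (_∷_)
open import Data.List.Relation.Unary.Any using (here; there)
import Data.List.Membership.Propositional as List
open import Data.List.Membership.Propositional.Properties
  using (∈-map⁺; ∈-++⁺ˡ; ∈-++⁺ʳ; ∈-map∘filter⁺; ∈-map∘filter⁻)
open import Data.Product using (_,_; proj₂)
open import Data.Sum using (inj₁; inj₂)
open import Data.Empty using (⊥-elim)
open import Relation.Nullary using (¬_)
open import Relation.Binary.PropositionalEquality
  using (_≡_; refl; sym; trans; cong; subst; subst₂; module ≡-Reasoning)
open import Function.Bundles using (Equivalence; _⇔_; mk⇔)
open import Algebra.Bundles using (CommutativeRing)

encode : ∀ {n} → Subset n → ℕ
encode []            = 0
encode (outside ∷ p) = 2 ℕ.* encode p
encode (inside  ∷ p) = suc (2 ℕ.* encode p)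

encode-injective : ∀ {n} (p q : Subset n) → encode p ≡ encode q → p ≡ q
encode-injective []            []            _  = refl
encode-injective (outside ∷ p) (outside ∷ q) eq =
  cong (outside ∷_) (encode-injective p q (*-cancelˡ-≡ (encode p) (encode q) 2 eq))
encode-injective (inside ∷ p)  (inside ∷ q)  eq =
  cong (inside ∷_) (encode-injective p q (*-cancelˡ-≡ (encode p) (encode q) 2 (suc-injective eq)))
encode-injective (outside ∷ p) (inside ∷ q)  eq = ⊥-elim (even≢odd (encode p) (encode q) eq)
encode-injective (inside ∷ p)  (outside ∷ q) eq = ⊥-elim (even≢odd (encode q) (encode p) (sym eq))

subsets : ∀ n → List (Subset n)
subsets zero    = [] ∷ []
subsets (suc n) = map (inside ∷_) (subsets n) ++ map (outside ∷_) (subsets n)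

∈-subsets : ∀ {n} (p : Subset n) → p List.∈ subsets n
∈-subsets []            = here refl
∈-subsets (inside ∷ p)  = ∈-++⁺ˡ (∈-map⁺ (inside ∷_) (∈-subsets p))
∈-subsets {suc n} (outside ∷ p) =
  ∈-++⁺ʳ (map (inside ∷_) (subsets n)) (∈-map⁺ (outside ∷_) (∈-subsets p))

module _ {ℓ : Level} (ℝ : RealField ℓ) where
  open RealField ℝ
  open Plane ℝ

  private
    commutativeRing : CommutativeRing ℓ ℓ
    commutativeRing = record { isCommutativeRing = isCommutativeRing }

  open CommutativeRing commutativeRing
    using (+-assoc; +-comm; +-identityˡ; +-identityʳ; -‿inverseʳ;
           zeroˡ; *-identityˡ; *-identityʳ; ring; +-rawMonoid)
  open import Algebra.Properties.Ring ring
    using (-0#≈0#; -‿distribˡ-*; -‿distribʳ-*; -‿involutive; +-cancelˡ; x∙y⁻¹≈ε⇒x≈y)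
  open import Algebra.Definitions.RawMonoid +-rawMonoid using () renaming (_×_ to _×ₙ_)

  0≤1 : 0# ≤ 1#
  0≤1 with ≤-total 0# 1#
  ... | inj₁ 0≤1 = 0≤1
  ... | inj₂ 1≤0 = ⊥-elim (0≢1 (≤-antisym 0≤1′ 1≤0))
    where
    0≤-1 : 0# ≤ - 1#
    0≤-1 = subst₂ _≤_ (-‿inverseʳ 1#) (+-identityˡ (- 1#)) (+-mono-≤ (- 1#) 1≤0)
    -1*-1≡1 : - 1# * - 1# ≡ 1#
    -1*-1≡1 = trans (sym (-‿distribˡ-* 1# (- 1#)))
                    (trans (cong -_ (*-identityˡ (- 1#))) (-‿involutive 1#))
    0≤1′ : 0# ≤ 1#
    0≤1′ = subst (0# ≤_) -1*-1≡1 (*-nonneg 0≤-1 0≤-1)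

  1≤1+x : ∀ {x} → 0# ≤ x → 1# ≤ 1# + x
  1≤1+x {x} 0≤x = subst₂ _≤_ (+-identityˡ 1#) (+-comm x 1#) (+-mono-≤ 1# 0≤x)

  ×ₙ1-nonneg : ∀ n → 0# ≤ n ×ₙ 1#
  ×ₙ1-nonneg zero    = ≤-refl
  ×ₙ1-nonneg (suc n) = ≤-trans 0≤1 (1≤1+x (×ₙ1-nonneg n))

  suc×ₙ1≢0 : ∀ n → ¬ (suc n ×ₙ 1# ≡ 0#)
  suc×ₙ1≢0 n eq = 0≢1 (≤-antisym 0≤1 (subst (1# ≤_) eq (1≤1+x (×ₙ1-nonneg n))))

  ×ₙ1-injective : ∀ m n → m ×ₙ 1# ≡ n ×ₙ 1# → m ≡ n
  ×ₙ1-injective zero    zero    _  = refl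
  ×ₙ1-injective zero    (suc n) eq = ⊥-elim (suc×ₙ1≢0 n (sym eq))
  ×ₙ1-injective (suc m) zero    eq = ⊥-elim (suc×ₙ1≢0 m eq)
  ×ₙ1-injective (suc m) (suc n) eq = cong suc (×ₙ1-injective m n (+-cancelˡ 1# _ _ eq))

  segment-from-axis : ∀ {x a qx qy} → OnSegment (x , 0#) (a , 1#) (qx , qy) →
                      qy ≡ 0# → qx ≡ x
  segment-from-axis {x} {a} {qx} {qy} (t , _ , _ , qx≡ , qy≡) qy≡0 = begin
    qx                  ≡⟨ qx≡ ⟩
    x + t * (a + - x)   ≡⟨ cong (λ s → x + s * (a + - x)) t≡0 ⟩
    x + 0# * (a + - x)  ≡⟨ cong (x +_) (zeroˡ _) ⟩
    x + 0#              ≡⟨ +-identityʳ x ⟩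
    x                   ∎
    where
    open ≡-Reasoning
    t≡0 : t ≡ 0#
    t≡0 = begin
      t                   ≡⟨ sym (*-identityʳ t) ⟩
      t * 1#              ≡⟨ cong (t *_) (sym (trans (cong (1# +_) -0#≈0#) (+-identityʳ 1#))) ⟩
      t * (1# + - 0#)     ≡⟨ sym (+-identityˡ _) ⟩
      0# + t * (1# + - 0#) ≡⟨ sym qy≡ ⟩
      qy                  ≡⟨ qy≡0 ⟩
      0#                  ∎

  segment-to-axis : ∀ {x a qx qy} → OnSegment (a , 1#) (x , 0#) (qx , qy) →
                    qy ≡ 0# → qx ≡ x
  segment-to-axis {x} {a} {qx} {qy} (t , _ , _ , qx≡ , qy≡) qy≡0 = begin
    qx                  ≡⟨ qx≡ ⟩
    a + t * (x + - a)   ≡⟨ cong (λ s → a + s * (x + - a)) (sym 1≡t) ⟩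
    a + 1# * (x + - a)  ≡⟨ cong (a +_) (*-identityˡ _) ⟩
    a + (x + - a)       ≡⟨ cong (a +_) (+-comm x (- a)) ⟩
    a + (- a + x)       ≡⟨ sym (+-assoc a (- a) x) ⟩
    (a + - a) + x       ≡⟨ cong (_+ x) (-‿inverseʳ a) ⟩
    0# + x              ≡⟨ +-identityˡ x ⟩
    x                   ∎
    where
    open ≡-Reasoning
    1≡t : 1# ≡ t
    1≡t = x∙y⁻¹≈ε⇒x≈y 1# t (begin
      1# + - t              ≡⟨ cong (1# +_) (sym (*-identityʳ (- t))) ⟩
      1# + - t * 1#         ≡⟨ cong (1# +_) (sym (-‿distribˡ-* t 1#)) ⟩
      1# + - (t * 1#)       ≡⟨ cong (1# +_) (-‿distribʳ-* t 1#) ⟩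
      1# + t * - 1#         ≡⟨ cong (λ s → 1# + t * s) (sym (+-identityˡ (- 1#))) ⟩
      1# + t * (0# + - 1#)  ≡⟨ sym qy≡ ⟩
      qy                    ≡⟨ qy≡0 ⟩
      0#                    ∎)

  segment-start : ∀ p p′ → OnSegment p p′ p
  segment-start (x , y) (x′ , y′) = 0# , ≤-refl , 0≤1 , stays x x′ , stays y y′
    where
    stays : ∀ u u′ → u ≡ u + 0# * (u′ + - u)
    stays u u′ = sym (trans (cong (u +_) (zeroˡ _)) (+-identityʳ u))

  apex : Point
  apex = (0# , 1#)

  zigzag : List Carrier → List Point
  zigzag []       = []
  zigzag (x ∷ xs) = (x , 0#) ∷ apex ∷ zigzag xs

  zigzag-visits : ∀ {x xs} → x List.∈ xs → OnPath apex (zigzag xs) (x , 0#)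
  zigzag-visits {x} (here refl)  = inj₂ (inj₁ (segment-start (x , 0#) apex))
  zigzag-visits     (there x∈xs) = inj₂ (inj₂ (zigzag-visits x∈xs))

  zigzag-axis : ∀ {xs qx qy} → OnPath apex (zigzag xs) (qx , qy) → qy ≡ 0# → qx List.∈ xs
  zigzag-axis {[]}    q≡apex               qy≡0 = ⊥-elim (0≢1 (trans (sym qy≡0) (cong proj₂ q≡apex)))
  zigzag-axis {_ ∷ _} (inj₁ down)          qy≡0 = here (segment-to-axis down qy≡0)
  zigzag-axis {_ ∷ _} (inj₂ (inj₁ up))     qy≡0 = here (segment-from-axis up qy≡0)
  zigzag-axis {_ ∷ _} (inj₂ (inj₂ onRest)) qy≡0 = there (zigzag-axis onRest qy≡0)

  pointRectangle : Point → Rectangle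
  pointRectangle (x , y) = rect x x y y ≤-refl ≤-refl

  meets-pointRectangle : ∀ t p → Meets t (pointRectangle p) ⇔ OnTrajectory t p
  meets-pointRectangle t (x , y) = mk⇔ to from
    where
    to : Meets t (pointRectangle (x , y)) → OnTrajectory t (x , y)
    to ((qx , qy) , on , x≤qx , qx≤x , y≤qy , qy≤y)
      with refl ← ≤-antisym qx≤x x≤qx | refl ← ≤-antisym qy≤y y≤qy = on
    from : OnTrajectory t (x , y) → Meets t (pointRectangle (x , y))
    from on = (x , y) , on , ≤-refl , ≤-refl , ≤-refl , ≤-refl

  abscissa : ∀ {n} → Subset n → Carrier
  abscissa p = encode p ×ₙ 1#

  abscissa-injective : ∀ {n} (p q : Subset n) → abscissa p ≡ abscissa q → p ≡ q
  abscissa-injective p q eq = encode-injective p q (×ₙ1-injective (encode p) (encode q) eq)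

  trajectory : ∀ {n} → Fin n → Trajectory
  trajectory {n} i = apex ∷ zigzag (map abscissa (filter (i ∈?_) (subsets n)))

  trajectories-shattered : ∀ n → Shattered n trajectory
  trajectories-shattered n p = pointRectangle x_p , λ i → mk⇔ (visited i) (member i)
    where
    x_p : Point
    x_p = (abscissa p , 0#)
    visited : ∀ i → i ∈ p → Meets (trajectory i) (pointRectangle x_p)
    visited i i∈p = Equivalence.from (meets-pointRectangle (trajectory i) x_p)
      (zigzag-visits (∈-map∘filter⁺ abscissa (i ∈?_) (p , ∈-subsets p , refl , i∈p)))
    member : ∀ i → Meets (trajectory i) (pointRectangle x_p) → i ∈ p
    member i meets
      with q , _ , abscissa-p≡q , i∈q ← ∈-map∘filter⁻ abscissa (i ∈?_) {xs = subsets n}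
             (zigzag-axis (Equivalence.to (meets-pointRectangle (trajectory i) x_p) meets) refl)
      = subst (i ∈_) (sym (abscissa-injective p q abscissa-p≡q)) i∈q

mainTheorem5 : ∀ {ℓ : Level} (ℝ : RealField ℓ) → Plane.UnboundedVCDim ℝ
mainTheorem5 ℝ n = trajectory ℝ , trajectories-shattered ℝ n
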